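{- The sparing number of the Frucht graph is $3$.
   Context: For $A,B\subseteq\mathbb{N}_0$, $A+B=\{a+b: a\in A, b\in B\}$. An integer additive set-indexer (IASI) of a graph $G$ is an injective $f:V(G)\to 2^{\mathbb{N}_0}$ such that $g_f(uv)=f(u)+f(v)$ is injective on $E(G)$. It is a weak IASI if $|g_f(uv)|=\max(|f(u)|,|f(v)|)$ for every edge $uv$. An edge is mono-indexed if its set-label has cardinality $1$. The sparing number $\varphi(G)$ is the minimum, over all weak IASIs of $G$, of the number of mono-indexed edges. The Frucht graph is the standard $3$-regular graph with $12$ vertices and $18$ edges having trivial automorphism group. -}

module Defs where

open import Data.Nat using (ℕ; _+_; _≤_; _⊔_; _≟_)
open import Data.Fin using (Fin; zero; suc; #_)
open import Data.List using (List; []; _∷_; length; deduplicate; cartesianProductWith; filter; allFin)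
open import Data.List.Membership.Propositional using (_∈_)
open import Data.Product using (_×_; _,_; ∃; proj₁; proj₂)
open import Relation.Binary.PropositionalEquality using (_≡_)

-- Finite subsets of ℕ₀, represented by lists (order and repetitions
-- are irrelevant: sets are compared by membership).

FinSet : Set
FinSet = List ℕ

_≈ˢ_ : FinSet → FinSet → Set
A ≈ˢ B = ∀ x → (x ∈ A → x ∈ B) × (x ∈ B → x ∈ A)

card : FinSet → ℕ
card A = length (deduplicate _≟_ A)

_⊕_ : FinSet → FinSet → FinSet
A ⊕ B = cartesianProductWith _+_ A B

record Graph : Set where
  field
    nV   : ℕ
    nE   : ℕ
    ends : Fin nE → Fin nV × Fin nV

open Graph public

module _ (G : Graph) where

  edgeLabel : (Fin (nV G) → FinSet) → Fin (nE G) → FinSet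
  edgeLabel f e = f (proj₁ (ends G e)) ⊕ f (proj₂ (ends G e))

  IsIASI : (Fin (nV G) → FinSet) → Set
  IsIASI f =
    (∀ u v → f u ≈ˢ f v → u ≡ v) ×
    (∀ e e′ → edgeLabel f e ≈ˢ edgeLabel f e′ → e ≡ e′)

  IsWeakIASI : (Fin (nV G) → FinSet) → Set
  IsWeakIASI f = IsIASI f ×
    (∀ e → card (edgeLabel f e) ≡ card (f (proj₁ (ends G e))) ⊔ card (f (proj₂ (ends G e))))

  monoCount : (Fin (nV G) → FinSet) → ℕ
  monoCount f = length (filter (λ e → card (edgeLabel f e) ≟ 1) (allFin (nE G)))

  IsSparingNumber : ℕ → Set
  IsSparingNumber k =
    (∃ λ f → IsWeakIASI f × monoCount f ≡ k) ×
    (∀ f → IsWeakIASI f → k ≤ monoCount f)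

-- The Frucht graph, LCF notation [-5,-2,-4,2,5,-2,2,5,-2,-5,4,2]:
-- Hamiltonian cycle 0-1-...-11-0 plus chords
-- {0,7},{1,11},{2,10},{3,5},{4,9},{6,8}.

fruchtEnds : Fin 18 → Fin 12 × Fin 12
fruchtEnds e = go e
  where
  go : Fin 18 → Fin 12 × Fin 12
  go zero = # 0 , # 1
  go (suc zero) = # 1 , # 2
  go (suc (suc zero)) = # 2 , # 3
  go (suc (suc (suc zero))) = # 3 , # 4
  go (suc (suc (suc (suc zero)))) = # 4 , # 5
  go (suc (suc (suc (suc (suc zero))))) = # 5 , # 6
  go (suc (suc (suc (suc (suc (suc zero)))))) = # 6 , # 7
  go (suc (suc (suc (suc (suc (suc (suc zero))))))) = # 7 , # 8
  go (suc (suc (suc (suc (suc (suc (suc (suc zero)))))))) = # 8 , # 9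
  go (suc (suc (suc (suc (suc (suc (suc (suc (suc zero))))))))) = # 9 , # 10
  go (suc (suc (suc (suc (suc (suc (suc (suc (suc (suc zero)))))))))) = # 10 , # 11
  go (suc (suc (suc (suc (suc (suc (suc (suc (suc (suc (suc zero))))))))))) = # 11 , # 0
  go (suc (suc (suc (suc (suc (suc (suc (suc (suc (suc (suc (suc zero)))))))))))) = # 0 , # 7
  go (suc (suc (suc (suc (suc (suc (suc (suc (suc (suc (suc (suc (suc zero))))))))))))) = # 1 , # 11
  go (suc (suc (suc (suc (suc (suc (suc (suc (suc (suc (suc (suc (suc (suc zero)))))))))))))) = # 2 , # 10
  go (suc (suc (suc (suc (suc (suc (suc (suc (suc (suc (suc (suc (suc (suc (suc zero))))))))))))))) = # 3 , # 5
  go (suc (suc (suc (suc (suc (suc (suc (suc (suc (suc (suc (suc (suc (suc (suc (suc zero)))))))))))))))) = # 4 , # 9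
  go (suc (suc (suc (suc (suc (suc (suc (suc (suc (suc (suc (suc (suc (suc (suc (suc (suc zero))))))))))))))))) = # 6 , # 8

frucht : Graph
frucht = record { nV = 12 ; nE = 18 ; ends = fruchtEnds }

-- If |A|, |B| ≥ 2 then |A + B| > max(|A|, |B|): for b < b′ in B, the set A + B contains A + b
-- and also max A + b′. So in a weak IASI of a loopless graph every edge has an endpoint with a
-- singleton label (two empty labels would coincide), i.e. the singleton-labelled vertices form a
-- vertex cover, and every edge it spans is mono-indexed. Searching all 2¹² vertex subsets shows
-- that every vertex cover of the Frucht graph spans at least three edges; labelling an independent
-- set of five vertices with two-element sets and the rest with singletons attains three.

module Submission where

open import Defs
open import Data.Bool using (T)
open import Data.Empty using (⊥-elim)
open import Data.Fin using (Fin) renaming (_≟_ to _≟ᶠ_)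
open import Data.Fin.Properties using (all?)
open import Data.Fin.Subset using (Subset) renaming (_∈_ to _∈ˢ_)
open import Data.Fin.Subset.Properties using (anySubset?) renaming (_∈?_ to _∈ˢ?_)
open import Data.List using (List; []; _∷_; length; map; filter; deduplicate; allFin)
open import Data.List.Extrema.Nat using (max; argmax-sel; ⊥≤max; xs≤max)
open import Data.List.Membership.Propositional using (_∈_)
open import Data.List.Membership.Propositional.Properties
  using (∈-deduplicate⁺; ∈-deduplicate⁻; ∈-cartesianProductWith⁺; ∈-cartesianProductWith⁻; ∈-map⁻; ∈-filter⁺)
open import Data.List.Properties using (length-map; filter-notAll)
import Data.List.Relation.Binary.Sublist.Propositional as Sublist
open import Data.List.Relation.Binary.Sublist.Heterogeneous.Properties using (length-mono-≤; ⊆-filter-Sublist)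
open import Data.List.Relation.Unary.All as All using (All)
open import Data.List.Relation.Unary.All.Properties using (map⁺)
open import Data.List.Relation.Unary.Any as Any using (Any; here; there)
open import Data.List.Relation.Unary.Unique.Propositional using (Unique; _∷_)
open import Data.List.Relation.Unary.Unique.Propositional.Properties using () renaming (map⁺ to Unique-map⁺)
open import Data.Nat using (ℕ; suc; _+_; _≤_; _<_; _⊔_; _≟_; _≡ᵇ_; _<?_; z≤n; s≤s)
open import Data.Nat.Properties
open import Data.List.Relation.Binary.Subset.DecPropositional _≟_ using (_⊆_; _⊆?_)
open import Data.List.Relation.Unary.Unique.DecPropositional.Properties _≟_ using (deduplicate-!)
open import Data.Product using (_×_; _,_; ∃; ∃₂; proj₁; proj₂)
open import Data.Sum as Sum using (_⊎_; inj₁; inj₂)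
open import Data.Vec using (Vec; []; _∷_; lookup; tabulate)
open import Data.Vec.Properties using (lookup∘tabulate; []=⇒lookup; lookup⇒[]=)
open import Function using (_∘_; case_of_)
open import Relation.Nullary using (¬_; ¬?; Dec; yes; no; _×-dec_; _⊎-dec_)
open import Relation.Nullary.Decidable using (from-yes; from-no; map′; _→-dec_)
import Relation.Unary as U
open import Relation.Binary.Definitions using (tri<; tri≈; tri>)
open import Relation.Binary.PropositionalEquality

Unique⇒length≤ : {xs ys : List ℕ} → Unique xs → xs ⊆ ys → length xs ≤ length ys
Unique⇒length≤ {[]} _ _ = z≤n
Unique⇒length≤ {x ∷ xs} {ys} (x∉xs ∷ !xs) x∷xs⊆ys =
  ≤-trans (s≤s (Unique⇒length≤ !xs xs⊆ys-x)) (filter-notAll x≢? ys x∈ys)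
  where
  x≢? : U.Decidable (x ≢_)
  x≢? y = ¬? (x ≟ y)

  xs⊆ys-x : xs ⊆ filter x≢? ys
  xs⊆ys-x z∈xs = ∈-filter⁺ x≢? (x∷xs⊆ys (there z∈xs)) (All.lookup x∉xs z∈xs)

  x∈ys : Any (U.∁ (x ≢_)) ys
  x∈ys = Any.map (λ x≡y x≢y → x≢y x≡y) (x∷xs⊆ys (here refl))

length-filter-mono : ∀ {a p q} {A : Set a} {P : U.Pred A p} {Q : U.Pred A q}
                     (P? : U.Decidable P) (Q? : U.Decidable Q) → P U.⊆ Q →
                     (xs : List A) → length (filter P? xs) ≤ length (filter Q? xs)
length-filter-mono P? Q? P⊆Q xs =
  length-mono-≤ (⊆-filter-Sublist P? Q? (λ { refl → P⊆Q }) (Sublist.⊆-refl {x = xs}))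

Unique⇒length≤card : {xs : List ℕ} {A : FinSet} → Unique xs → xs ⊆ A → length xs ≤ card A
Unique⇒length≤card !xs xs⊆A = Unique⇒length≤ !xs (∈-deduplicate⁺ _≟_ ∘ xs⊆A)

card-mono : {A B : FinSet} → A ⊆ B → card A ≤ card B
card-mono {A} A⊆B = Unique⇒length≤card (deduplicate-! A) (A⊆B ∘ ∈-deduplicate⁻ _≟_ A)

_≈ˢ?_ : (A B : FinSet) → Dec (A ≈ˢ B)
A ≈ˢ? B = map′
  (λ (A⊆B , B⊆A) _ → (λ x∈A → A⊆B x∈A) , (λ x∈B → B⊆A x∈B))
  (λ A≈B → (λ {x} → proj₁ (A≈B x)) , (λ {x} → proj₂ (A≈B x)))
  ((A ⊆? B) ×-dec (B ⊆? A))

⊕-comm-⊆ : (A B : FinSet) → A ⊕ B ⊆ B ⊕ A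
⊕-comm-⊆ A B v∈A⊕B with a , b , a∈A , b∈B , refl ← ∈-cartesianProductWith⁻ _+_ A B v∈A⊕B =
  subst (_∈ B ⊕ A) (+-comm b a) (∈-cartesianProductWith⁺ _+_ b∈B a∈A)

card-⊕-comm : (A B : FinSet) → card (A ⊕ B) ≡ card (B ⊕ A)
card-⊕-comm A B = ≤-antisym (card-mono (⊕-comm-⊆ A B)) (card-mono (⊕-comm-⊆ B A))

max-∈ : (x : ℕ) (xs : List ℕ) → max x xs ∈ x ∷ xs
max-∈ x xs with argmax-sel (λ y → y) x xs
... | inj₁ max≡x = here max≡x
... | inj₂ max∈xs = there max∈xs

≤max : (x : ℕ) (xs : List ℕ) → All (_≤ max x xs) (x ∷ xs)
≤max x xs = ⊥≤max x xs All.∷ xs≤max x xs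

Unique⇒<-pair : {xs : List ℕ} → Unique xs → 2 ≤ length xs → ∃₂ λ a a′ → a ∈ xs × a′ ∈ xs × a < a′
Unique⇒<-pair {x ∷ y ∷ _} ((x≢y All.∷ _) ∷ _) _ with <-cmp x y
... | tri< x<y _ _ = x , y , here refl , there (here refl) , x<y
... | tri≈ _ x≡y _ = ⊥-elim (x≢y x≡y)
... | tri> _ _ y<x = y , x , there (here refl) , here refl , y<x
Unique⇒<-pair {_ ∷ []} _ (s≤s ())

2≤card⇒<-pair : {A : FinSet} → 2 ≤ card A → ∃₂ λ a a′ → a ∈ A × a′ ∈ A × a < a′
2≤card⇒<-pair {A} 2≤∣A∣ with a , a′ , a∈ , a′∈ , a<a′ ← Unique⇒<-pair (deduplicate-! A) 2≤∣A∣ =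
  a , a′ , ∈-deduplicate⁻ _≟_ A a∈ , ∈-deduplicate⁻ _≟_ A a′∈ , a<a′

card<card-⊕ : (A B : FinSet) → 1 ≤ card A → 2 ≤ card B → card A < card (A ⊕ B)
card<card-⊕ A@(a ∷ as) B _ 2≤∣B∣ with b , b′ , b∈B , b′∈B , b<b′ ← 2≤card⇒<-pair {B} 2≤∣B∣ =
  subst (_≤ card (A ⊕ B)) (cong suc (length-map (_+ b) D)) (Unique⇒length≤card unique sub)
  where
  D : List ℕ
  D = deduplicate _≟_ A

  top : ℕ
  top = max a as + b′

  below-top : All (top ≢_) (map (_+ b) D)
  below-top = map⁺ (All.tabulate λ {z} z∈D top≡z+b →
    <-irrefl (sym top≡z+b) (+-mono-≤-< (All.lookup (≤max a as) (∈-deduplicate⁻ _≟_ A z∈D)) b<b′))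

  unique : Unique (top ∷ map (_+ b) D)
  unique = below-top ∷ Unique-map⁺ (+-cancelʳ-≡ b _ _) (deduplicate-! A)

  sub : top ∷ map (_+ b) D ⊆ A ⊕ B
  sub (here refl) = ∈-cartesianProductWith⁺ _+_ (max-∈ a as) b′∈B
  sub (there z∈) with w , w∈D , refl ← ∈-map⁻ (_+ b) z∈ =
    ∈-cartesianProductWith⁺ _+_ (∈-deduplicate⁻ _≟_ A w∈D) b∈B

⊔<card-⊕ : (A B : FinSet) → 2 ≤ card A → 2 ≤ card B → card A ⊔ card B < card (A ⊕ B)
⊔<card-⊕ A B 2≤∣A∣ 2≤∣B∣ = ⊔-lub
  (card<card-⊕ A B (≤-trans (s≤s z≤n) 2≤∣A∣) 2≤∣B∣)
  (subst (card B <_) (card-⊕-comm B A) (card<card-⊕ B A (≤-trans (s≤s z≤n) 2≤∣B∣) 2≤∣A∣))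

card-⊕≡⊔⇒singleton : (A B : FinSet) → ¬ (A ≡ [] × B ≡ []) →
                     card (A ⊕ B) ≡ card A ⊔ card B → card A ≡ 1 ⊎ card B ≡ 1
card-⊕≡⊔⇒singleton [] [] nonempty _ = ⊥-elim (nonempty (refl , refl))
card-⊕≡⊔⇒singleton [] (_ ∷ _) _ ()
card-⊕≡⊔⇒singleton A@(_ ∷ _) [] _ eq = case trans (card-⊕-comm [] A) eq of λ ()
card-⊕≡⊔⇒singleton A@(_ ∷ _) B@(_ ∷ _) _ eq with card A ≟ 1 | card B ≟ 1
... | yes ∣A∣≡1 | _ = inj₁ ∣A∣≡1
... | no _ | yes ∣B∣≡1 = inj₂ ∣B∣≡1
... | no ∣A∣≢1 | no ∣B∣≢1 =
  ⊥-elim (<-irrefl (sym eq) (⊔<card-⊕ A B (≤∧≢⇒< (s≤s z≤n) (≢-sym ∣A∣≢1)) (≤∧≢⇒< (s≤s z≤n) (≢-sym ∣B∣≢1))))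

module _ (G : Graph) where

  private
    head tail : Fin (nE G) → Fin (nV G)
    head e = proj₁ (ends G e)
    tail e = proj₂ (ends G e)

  Loopless : Set
  Loopless = ∀ e → head e ≢ tail e

  IsVertexCover : Subset (nV G) → Set
  IsVertexCover S = ∀ e → head e ∈ˢ S ⊎ tail e ∈ˢ S

  isVertexCover? : U.Decidable IsVertexCover
  isVertexCover? S = all? (λ e → (head e ∈ˢ? S) ⊎-dec (tail e ∈ˢ? S))

  spannedEdgeCount : Subset (nV G) → ℕ
  spannedEdgeCount S = length (filter (λ e → (head e ∈ˢ? S) ×-dec (tail e ∈ˢ? S)) (allFin (nE G)))

  singletonVertices : (Fin (nV G) → FinSet) → Subset (nV G)
  singletonVertices f = tabulate (λ i → card (f i) ≡ᵇ 1)

  module _ {f : Fin (nV G) → FinSet} where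

    ∈-singletonVertices⁺ : ∀ {i} → card (f i) ≡ 1 → i ∈ˢ singletonVertices f
    ∈-singletonVertices⁺ {i} ∣fi∣≡1 = lookup⇒[]= i _
      (trans (lookup∘tabulate _ i) (cong (_≡ᵇ 1) ∣fi∣≡1))

    ∈-singletonVertices⁻ : ∀ {i} → i ∈ˢ singletonVertices f → card (f i) ≡ 1
    ∈-singletonVertices⁻ {i} i∈S = ≡ᵇ⇒≡ (card (f i)) 1
      (subst T (trans (sym ([]=⇒lookup i∈S)) (lookup∘tabulate _ i)) _)

    weakIASI⇒singleton-end : Loopless → IsWeakIASI G f → ∀ e → card (f (head e)) ≡ 1 ⊎ card (f (tail e)) ≡ 1
    weakIASI⇒singleton-end loopless ((f-injective , _) , weak) e =
      card-⊕≡⊔⇒singleton (f (head e)) (f (tail e)) not-both-empty (weak e)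
      where
      not-both-empty : ¬ (f (head e) ≡ [] × f (tail e) ≡ [])
      not-both-empty (fu≡[] , fv≡[]) = loopless e (f-injective _ _ λ x →
        subst (x ∈_) fu≡fv , subst (x ∈_) (sym fu≡fv))
        where
        fu≡fv : f (head e) ≡ f (tail e)
        fu≡fv = trans fu≡[] (sym fv≡[])

    singletonVertices-isVertexCover : Loopless → IsWeakIASI G f → IsVertexCover (singletonVertices f)
    singletonVertices-isVertexCover loopless weakIASI e =
      Sum.map ∈-singletonVertices⁺ ∈-singletonVertices⁺ (weakIASI⇒singleton-end loopless weakIASI e)

    spannedEdgeCount-singletonVertices≤monoCount : IsWeakIASI G f → spannedEdgeCount (singletonVertices f) ≤ monoCount G f
    spannedEdgeCount-singletonVertices≤monoCount (_ , weak) =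
      length-filter-mono _ _ spanned⇒mono (allFin (nE G))
      where
      spanned⇒mono : ∀ {e} → head e ∈ˢ singletonVertices f × tail e ∈ˢ singletonVertices f → card (edgeLabel G f e) ≡ 1
      spanned⇒mono {e} (u∈S , v∈S) = trans (weak e) (cong₂ _⊔_ (∈-singletonVertices⁻ u∈S) (∈-singletonVertices⁻ v∈S))

  sparingNumber-lowerBound : Loopless → ∀ {k} → (∀ S → IsVertexCover S → k ≤ spannedEdgeCount S) →
                             ∀ f → IsWeakIASI G f → k ≤ monoCount G f
  sparingNumber-lowerBound loopless covers-span f weakIASI = ≤-trans
    (covers-span _ (singletonVertices-isVertexCover loopless weakIASI))
    (spannedEdgeCount-singletonVertices≤monoCount weakIASI)

frucht-loopless : Loopless frucht
frucht-loopless = from-yes (all? λ e → ¬? (proj₁ (fruchtEnds e) ≟ᶠ proj₂ (fruchtEnds e)))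

frucht-vertexCover-spans≥3 : ∀ S → IsVertexCover frucht S → 3 ≤ spannedEdgeCount frucht S
frucht-vertexCover-spans≥3 S cover = ≮⇒≥ λ spans<3 → no-small-cover (S , cover , spans<3)
  where
  no-small-cover : ¬ ∃ λ S → IsVertexCover frucht S × spannedEdgeCount frucht S < 3
  no-small-cover = from-no (anySubset? λ S → isVertexCover? frucht S ×-dec (spannedEdgeCount frucht S <? 3))

-- Two-element labels sit on the independent set {2, 5, 7, 9, 11}, so exactly the edges
-- 01, 34 and 68 join two singletons; building every label from its own power of two keeps
-- all vertex and edge labels distinct.
fruchtLabelling : Fin 12 → FinSet
fruchtLabelling = lookup labels
  where
  labels : Vec FinSet 12
  labels = (1 ∷ []) ∷ (2 ∷ []) ∷ (4 ∷ 5 ∷ []) ∷ (8 ∷ []) ∷ (16 ∷ []) ∷ (32 ∷ 33 ∷ []) ∷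
           (64 ∷ []) ∷ (128 ∷ 129 ∷ []) ∷ (256 ∷ []) ∷ (512 ∷ 513 ∷ []) ∷ (1024 ∷ []) ∷ (2048 ∷ 2049 ∷ []) ∷ []

fruchtLabelling-isWeakIASI : IsWeakIASI frucht fruchtLabelling
fruchtLabelling-isWeakIASI =
  ( from-yes (all? λ u → all? λ v → (f u ≈ˢ? f v) →-dec (u ≟ᶠ v))
  , from-yes (all? λ e → all? λ e′ → (edgeLabel frucht f e ≈ˢ? edgeLabel frucht f e′) →-dec (e ≟ᶠ e′)) )
  , from-yes (all? λ e → card (edgeLabel frucht f e) ≟ card (f (proj₁ (fruchtEnds e))) ⊔ card (f (proj₂ (fruchtEnds e))))
  where
  f : Fin 12 → FinSet
  f = fruchtLabelling

mainTheorem12 : IsSparingNumber frucht 3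
mainTheorem12 =
  (fruchtLabelling , fruchtLabelling-isWeakIASI , refl) ,
  sparingNumber-lowerBound frucht frucht-loopless frucht-vertexCover-spans≥3
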